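{- For a given terminating program $p_0$ of $\mathcal{W}$, the axiomatic semantics $[\![ p_0 ]\!]$ is $\mathcal{W}$-sound, i.e. $M \vDash [\![ p_0 ]\!]$ for every execution interpretation $M$ of $p_0$.
   Context: $[\![ p_0 ]\!] := \bigwedge_{s \text{ statement of } p_0} \forall \mathit{enclIts}.\,(\mathit{Reach}(\mathit{start}_s)\rightarrow [\![ s ]\!])$, where $\mathit{enclIts}$ are the iteration variables of loops enclosing $s$ and $[\![ s ]\!]$ is: for skip, all variables equal at $\mathit{end}_s$ and $\mathit{start}_s$; for $v=e$, $v(\mathit{end}_s)\simeq$ value of $e$ at $\mathit{start}_s$, other variables unchanged; for $a[e_1]=e_2$, $a$ at $\mathit{end}_s$ equals $a$ at $\mathit{start}_s$ except at position $e_1$ where it equals $e_2$ (evaluated at $\mathit{start}_s$), other variables unchanged; for if-then-else, if the condition holds (resp. fails) at $\mathit{start}_s$ all variables at the start of the then- (resp. else-)branch equal those at $\mathit{start}_s$; for $\mathtt{while(Cond)\{c\}}$, the condition holds at $tp_s(it)$ for all $it<\mathit{lastIt}_s$ and fails at $tp_s(\mathit{lastIt}_s)$, all variables at $\mathit{start}_c$ equal those at $tp_s(it)$ for $it<\mathit{lastIt}_s$, and all variables at $\mathit{end}_s$ equal those at $tp_s(\mathit{lastIt}_s)$. An execution interpretation is a first-order interpretation induced by a run of the small-step operational semantics of $\mathcal{W}$, interpreting $\mathit{Reach}$ as the set of reached timepoints and program variables according to the transition rules at reached timepoints. -}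

module Defs where

open import Data.Nat using (ℕ; zero; suc; _<_; _≤_)
open import Data.Integer as ℤ using (ℤ)
open import Data.Fin using (Fin)
import Data.Fin as Fin
open import Data.List using (List; []; _∷_; _++_; length)
open import Data.Product using (Σ; ∃; _×_; _,_; proj₁; proj₂)
open import Data.Sum using (_⊎_)
open import Data.Unit using (⊤)
open import Data.Empty using (⊥)
open import Data.Bool using (if_then_else_)
open import Relation.Nullary using (¬_)
open import Relation.Nullary.Decidable using (⌊_⌋)
open import Relation.Binary.PropositionalEquality using (_≡_)

-- Syntax of the language W.
-- A program has nI integer variables (Fin nI) and nA integer-array
-- variables (Fin nA); arrays are total maps ℤ → ℤ.

data Expr (nI nA : ℕ) : Set where
  const : ℤ → Expr nI nA
  var   : Fin nI → Expr nI nA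
  read  : Fin nA → Expr nI nA → Expr nI nA
  plus  : Expr nI nA → Expr nI nA → Expr nI nA
  minus : Expr nI nA → Expr nI nA → Expr nI nA
  times : Expr nI nA → Expr nI nA → Expr nI nA

data Cond (nI nA : ℕ) : Set where
  true false : Cond nI nA
  lt le eq   : Expr nI nA → Expr nI nA → Cond nI nA
  not        : Cond nI nA → Cond nI nA
  and or     : Cond nI nA → Cond nI nA → Cond nI nA

data Stmt (nI nA : ℕ) : Set where
  skip   : Stmt nI nA
  assign : Fin nI → Expr nI nA → Stmt nI nA
  awrite : Fin nA → Expr nI nA → Expr nI nA → Stmt nI nA        -- a[e1] = e2
  ite    : Cond nI nA → List (Stmt nI nA) → List (Stmt nI nA) → Stmt nI nA
  while  : Cond nI nA → List (Stmt nI nA) → Stmt nI nA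

Block : ℕ → ℕ → Set
Block nI nA = List (Stmt nI nA)

Program : ℕ → ℕ → Set
Program = Block

State : ℕ → ℕ → Set
State nI nA = (Fin nI → ℤ) × (Fin nA → ℤ → ℤ)

eval : ∀ {nI nA} → State nI nA → Expr nI nA → ℤ
eval σ (const z)     = z
eval σ (var v)       = proj₁ σ v
eval σ (read a e)    = proj₂ σ a (eval σ e)
eval σ (plus e₁ e₂)  = eval σ e₁ ℤ.+ eval σ e₂
eval σ (minus e₁ e₂) = eval σ e₁ ℤ.- eval σ e₂
eval σ (times e₁ e₂) = eval σ e₁ ℤ.* eval σ e₂

holds : ∀ {nI nA} → State nI nA → Cond nI nA → Set
holds σ true        = ⊤
holds σ false       = ⊥
holds σ (lt e₁ e₂)  = eval σ e₁ ℤ.< eval σ e₂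
holds σ (le e₁ e₂)  = eval σ e₁ ℤ.≤ eval σ e₂
holds σ (eq e₁ e₂)  = eval σ e₁ ≡ eval σ e₂
holds σ (not c)     = ¬ holds σ c
holds σ (and c₁ c₂) = holds σ c₁ × holds σ c₂
holds σ (or c₁ c₂)  = holds σ c₁ ⊎ holds σ c₂

updI : ∀ {nI nA} → State nI nA → Fin nI → ℤ → State nI nA
updI (ι , α) v z = (λ w → if ⌊ w Fin.≟ v ⌋ then z else ι w) , α

updA : ∀ {nI nA} → State nI nA → Fin nA → ℤ → ℤ → State nI nA
updA (ι , α) a k z =
  ι , (λ b i → if ⌊ b Fin.≟ a ⌋ then (if ⌊ i ℤ.≟ k ⌋ then z else α b i) else α b i)

EqState : ∀ {nI nA} → State nI nA → State nI nA → Set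
EqState {nI} {nA} σ τ =
  (∀ (v : Fin nI) → proj₁ σ v ≡ proj₁ τ v) × (∀ (a : Fin nA) (k : ℤ) → proj₂ σ a k ≡ proj₂ τ a k)

-- A timepoint is a path into the program recording, for each enclosing
-- loop, the iteration: tp_s(it₁,…,itₖ) for a statement s at index j of a
-- block whose location/iterations are encoded by the prefix `pre` is
--   pre ++ [stmt j]                 (s not a while)
--   pre ++ [stmt j , iter it]       (s a while, header at iteration it)
-- statements of a then/else branch of the ite at `pre ++ [stmt j]` have
-- prefix pre ++ [stmt j , thenB] / [stmt j , elseB]; statements of the
-- body of a while in iteration it have prefix pre ++ [stmt j , iter it].

data PStep : Set where
  stmt  : ℕ → PStep
  thenB : PStep
  elseB : PStep
  iter  : ℕ → PStep

TP : Set
TP = List PStep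

hdr : TP → ℕ → ℕ → TP
hdr pre j it = pre ++ stmt j ∷ iter it ∷ []

startS : ∀ {nI nA} → TP → ℕ → Stmt nI nA → TP
startS pre j (while c b) = hdr pre j 0
startS pre j _           = pre ++ stmt j ∷ []

startFrom : ∀ {nI nA} → TP → TP → ℕ → Block nI nA → TP
startFrom pre ex j []      = ex
startFrom pre ex j (s ∷ _) = startS pre j s

endP : ∀ {nI nA} → Program nI nA → TP
endP p = stmt (length p) ∷ []

startP : ∀ {nI nA} → Program nI nA → TP
startP p = startFrom [] (endP p) 0 p

-- Interpretations of trace logic (timepoints interpreted as timepoint
-- terms): Reach, values of program variables at timepoints, and the
-- function symbols lastIt_s (indexed by the location of the while s
-- including its enclosing iterations, pre ++ [stmt j]).

record Interp (nI nA : ℕ) : Set₁ where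
  field
    Reach  : TP → Set
    ival   : TP → Fin nI → ℤ
    aval   : TP → Fin nA → ℤ → ℤ
    lastIt : TP → ℕ

  at : TP → State nI nA
  at tp = ival tp , aval tp

-- SemS M pre end j s  is the truth of [[s]] (with the given values of
-- the enclosing iteration variables, encoded in pre), where end = end_s.

module _ {nI nA : ℕ} (M : Interp nI nA) where
  open Interp M

  SemS : TP → TP → ℕ → Stmt nI nA → Set
  SemS pre end j skip = EqState (at end) (at (pre ++ stmt j ∷ []))
  SemS pre end j (assign v e) =
    let st = pre ++ stmt j ∷ [] in
    (ival end v ≡ eval (at st) e)
    × (∀ w → ¬ (w ≡ v) → ival end w ≡ ival st w)
    × (∀ a k → aval end a k ≡ aval st a k)
  SemS pre end j (awrite a e₁ e₂) =
    let st = pre ++ stmt j ∷ [] in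
    (aval end a (eval (at st) e₁) ≡ eval (at st) e₂)
    × (∀ k → ¬ (k ≡ eval (at st) e₁) → aval end a k ≡ aval st a k)
    × (∀ b k → ¬ (b ≡ a) → aval end b k ≡ aval st b k)
    × (∀ v → ival end v ≡ ival st v)
  SemS pre end j (ite c t e) =
    let st = pre ++ stmt j ∷ [] in
    (holds (at st) c → EqState (at (startFrom (pre ++ stmt j ∷ thenB ∷ []) end 0 t)) (at st))
    × (¬ holds (at st) c → EqState (at (startFrom (pre ++ stmt j ∷ elseB ∷ []) end 0 e)) (at st))
  SemS pre end j (while c b) =
    let L = lastIt (pre ++ stmt j ∷ []) in
    (∀ it → it < L → holds (at (hdr pre j it)) c)
    × ¬ holds (at (hdr pre j L)) c
    × (∀ it → it < L →
         EqState (at (startFrom (hdr pre j it) (hdr pre j (suc it)) 0 b)) (at (hdr pre j it)))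
    × EqState (at end) (at (hdr pre j L))

  mutual
    -- conjunction over all statements s (occurring in s, including s) of
    -- ∀ enclIts. (Reach(start_s) → [[s]])
    SatS : TP → TP → ℕ → Stmt nI nA → Set
    SatS pre end j s = (Reach (startS pre j s) → SemS pre end j s) × SatSub pre end j s

    SatSub : TP → TP → ℕ → Stmt nI nA → Set
    SatSub pre end j (ite c t e) =
      SatB (pre ++ stmt j ∷ thenB ∷ []) end 0 t × SatB (pre ++ stmt j ∷ elseB ∷ []) end 0 e
    SatSub pre end j (while c b) =
      ∀ (it : ℕ) → SatB (hdr pre j it) (hdr pre j (suc it)) 0 b
    SatSub pre end j _ = ⊤

    -- block with prefix pre, exit timepoint ex, statements from index j
    SatB : TP → TP → ℕ → Block nI nA → Set
    SatB pre ex j []       = ⊤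
    SatB pre ex j (s ∷ ss) = SatS pre (startFrom pre ex (suc j) ss) j s × SatB pre ex (suc j) ss

_⊨⟦_⟧ : ∀ {nI nA} → Interp nI nA → Program nI nA → Set
M ⊨⟦ p ⟧ = SatB M [] (endP p) 0 p

Config : ℕ → ℕ → Set
Config nI nA = TP × State nI nA

mutual
  data StepS {nI nA : ℕ} : TP → TP → ℕ → Stmt nI nA → Config nI nA → Config nI nA → Set where
    skipR : ∀ {pre end j σ} → StepS pre end j skip (pre ++ stmt j ∷ [] , σ) (end , σ)
    assignR : ∀ {pre end j v e σ} →
      StepS pre end j (assign v e) (pre ++ stmt j ∷ [] , σ) (end , updI σ v (eval σ e))
    awriteR : ∀ {pre end j a e₁ e₂ σ} →
      StepS pre end j (awrite a e₁ e₂) (pre ++ stmt j ∷ [] , σ) (end , updA σ a (eval σ e₁) (eval σ e₂))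
    iteT : ∀ {pre end j c t e σ} → holds σ c →
      StepS pre end j (ite c t e) (pre ++ stmt j ∷ [] , σ)
                                  (startFrom (pre ++ stmt j ∷ thenB ∷ []) end 0 t , σ)
    iteF : ∀ {pre end j c t e σ} → ¬ holds σ c →
      StepS pre end j (ite c t e) (pre ++ stmt j ∷ [] , σ)
                                  (startFrom (pre ++ stmt j ∷ elseB ∷ []) end 0 e , σ)
    iteInT : ∀ {pre end j c t e κ κ'} →
      StepB (pre ++ stmt j ∷ thenB ∷ []) end 0 t κ κ' → StepS pre end j (ite c t e) κ κ'
    iteInE : ∀ {pre end j c t e κ κ'} →
      StepB (pre ++ stmt j ∷ elseB ∷ []) end 0 e κ κ' → StepS pre end j (ite c t e) κ κ'
    whileT : ∀ {pre end j c b it σ} → holds σ c →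
      StepS pre end j (while c b) (hdr pre j it , σ)
                                  (startFrom (hdr pre j it) (hdr pre j (suc it)) 0 b , σ)
    whileF : ∀ {pre end j c b it σ} → ¬ holds σ c →
      StepS pre end j (while c b) (hdr pre j it , σ) (end , σ)
    whileIn : ∀ {pre end j c b it κ κ'} →
      StepB (hdr pre j it) (hdr pre j (suc it)) 0 b κ κ' → StepS pre end j (while c b) κ κ'

  data StepB {nI nA : ℕ} : TP → TP → ℕ → Block nI nA → Config nI nA → Config nI nA → Set where
    here  : ∀ {pre ex j s ss κ κ'} →
      StepS pre (startFrom pre ex (suc j) ss) j s κ κ' → StepB pre ex j (s ∷ ss) κ κ'
    there : ∀ {pre ex j s ss κ κ'} →
      StepB pre ex (suc j) ss κ κ' → StepB pre ex j (s ∷ ss) κ κ'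

_⊢_⟶_ : ∀ {nI nA} → Program nI nA → Config nI nA → Config nI nA → Set
p ⊢ κ ⟶ κ' = StepB [] (endP p) 0 p κ κ'

record Execution {nI nA : ℕ} (p : Program nI nA) : Set where
  field
    len   : ℕ
    run   : ℕ → Config nI nA
    init  : proj₁ (run 0) ≡ startP p
    final : proj₁ (run len) ≡ endP p
    steps : ∀ i → i < len → p ⊢ run i ⟶ run (suc i)

Terminating : ∀ {nI nA} → Program nI nA → Set
Terminating {nI} {nA} p =
  ∀ (σ₀ : State nI nA) → Σ (Execution p) λ E → Execution.run E 0 ≡ (startP p , σ₀)

record IsExecInterp {nI nA : ℕ} (p : Program nI nA) (E : Execution p) (M : Interp nI nA) : Set where
  open Execution E
  open Interp M
  field
    reach-sound    : ∀ tp → Reach tp → ∃ λ i → i ≤ len × proj₁ (run i) ≡ tp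
    reach-complete : ∀ i → i ≤ len → Reach (proj₁ (run i))
    ival-run : ∀ i → i ≤ len → ∀ v → ival (proj₁ (run i)) v ≡ proj₁ (proj₂ (run i)) v
    aval-run : ∀ i → i ≤ len → ∀ a k → aval (proj₁ (run i)) a k ≡ proj₂ (proj₂ (run i)) a k
    lastIt-run : ∀ w n → Reach (w ++ iter n ∷ []) → ¬ Reach (w ++ iter (suc n) ∷ []) →
                 lastIt w ≡ n

module Submission where

-- A statement s whose start is reached is reached at some index t of E.  The
-- small-step semantics is deterministic, so E's next transition is the rule of
-- s firing at start_s; comparing M's values on both sides of it gives [[s]] for
-- skip, assignments, array writes and conditionals.  A loop is followed from
-- header to header: while the condition holds, E enters the body and, as a
-- block can step until it exits and E is finite, reaches the next header.  The
-- first header N where the condition fails is left for the end of the loop;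
-- since every transition increases the timepoint, header N+1 is never reached,
-- so lastIt_s = N.

open import Defs
open import Data.Nat using (ℕ; zero; suc; _<_; _≤_; _+_; z≤n; s≤s; _≤?_)
open import Data.Nat.Properties
  using (<-trans; <-irrefl; ≤-refl; ≤-trans; <⇒≤; <⇒≱; ≰⇒>; +-suc; +-monoʳ-≤; m<m+n; m≤m+n;
         m≤n⇒m<n∨m≡n)
import Data.Integer as ℤ
import Data.Fin as Fin
open import Data.List using ([]; _∷_; _++_; length)
open import Data.List.Properties using (++-assoc; ++-cancelˡ)
open import Data.Product using (Σ; ∃; ∃₂; _×_; _,_; proj₁; proj₂)
import Data.Product as Prod
open import Data.Sum using (_⊎_; inj₁; inj₂)
import Data.Sum as Sum
open import Data.Unit using (tt)
open import Data.Empty using (⊥-elim)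
open import Relation.Nullary using (¬_; Dec; yes; no)
open import Relation.Nullary.Decidable using (¬?; _×-dec_; _⊎-dec_)
open import Relation.Binary.PropositionalEquality

private variable nI nA : ℕ

-- (1) The order of timepoints

infix 4 _<ₚ_ _≺_ _≼_

data _<ₚ_ : PStep → PStep → Set where
  stmt< : ∀ {k k'} → k < k' → stmt k <ₚ stmt k'
  iter< : ∀ {k k'} → k < k' → iter k <ₚ iter k'

<ₚ-trans : ∀ {x y z} → x <ₚ y → y <ₚ z → x <ₚ z
<ₚ-trans (stmt< p) (stmt< q) = stmt< (<-trans p q)
<ₚ-trans (iter< p) (iter< q) = iter< (<-trans p q)

<ₚ-irrefl : ∀ {x} → ¬ x <ₚ x
<ₚ-irrefl (stmt< p) = <-irrefl refl p
<ₚ-irrefl (iter< p) = <-irrefl refl p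

-- Timepoints are ordered lexicographically, a path preceding its
-- extensions: the order in which executions visit them.
data _≺_ : TP → TP → Set where
  prefix : ∀ {x xs} → [] ≺ x ∷ xs
  head<  : ∀ {x y xs ys} → x <ₚ y → x ∷ xs ≺ y ∷ ys
  tail<  : ∀ {x xs ys} → xs ≺ ys → x ∷ xs ≺ x ∷ ys

≺-trans : ∀ {a b c} → a ≺ b → b ≺ c → a ≺ c
≺-trans prefix    (head< _) = prefix
≺-trans prefix    (tail< _) = prefix
≺-trans (head< p) (head< q) = head< (<ₚ-trans p q)
≺-trans (head< p) (tail< _) = head< p
≺-trans (tail< _) (head< q) = head< q
≺-trans (tail< p) (tail< q) = tail< (≺-trans p q)

≺-irrefl : ∀ {a} → ¬ a ≺ a
≺-irrefl (head< p) = <ₚ-irrefl p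
≺-irrefl (tail< p) = ≺-irrefl p

_≼_ : TP → TP → Set
a ≼ b = a ≡ b ⊎ a ≺ b

≼-≺-trans : ∀ {a b c} → a ≼ b → b ≺ c → a ≺ c
≼-≺-trans (inj₁ refl) q = q
≼-≺-trans (inj₂ p)    q = ≺-trans p q

≼-≺-asym : ∀ {a b} → a ≼ b → ¬ b ≺ a
≼-≺-asym p q = ≺-irrefl (≼-≺-trans p q)

≺-++ˡ : ∀ (Q : TP) {xs ys} → xs ≺ ys → Q ++ xs ≺ Q ++ ys
≺-++ˡ []      p = p
≺-++ˡ (_ ∷ Q) p = tail< (≺-++ˡ Q p)

≺-extend : ∀ (Q : TP) {x xs} → Q ≺ Q ++ x ∷ xs
≺-extend []      = prefix
≺-extend (_ ∷ Q) = tail< (≺-extend Q)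

hdr-≺ : ∀ Q j it → hdr Q j it ≺ hdr Q j (suc it)
hdr-≺ Q j it = ≺-++ˡ Q (tail< (head< (iter< ≤-refl)))

point-≺-branch : ∀ Q j x r → Q ++ stmt j ∷ [] ≺ (Q ++ stmt j ∷ x ∷ []) ++ r
point-≺-branch Q j x r =
  subst (Q ++ stmt j ∷ [] ≺_) (sym (++-assoc Q (stmt j ∷ x ∷ []) r)) (≺-++ˡ Q (tail< prefix))

body-≺-next : ∀ Q j it r → hdr Q j it ++ r ≺ hdr Q j (suc it)
body-≺-next Q j it r =
  subst (_≺ hdr Q j (suc it)) (sym (++-assoc Q (stmt j ∷ iter it ∷ []) r))
    (≺-++ˡ Q (tail< (head< (iter< ≤-refl))))

≺-startS : ∀ {tp} Q j (s : Stmt nI nA) →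
  (∀ r → tp ≺ Q ++ stmt j ∷ r) → tp ≺ startS Q j s
≺-startS Q j skip           h = h []
≺-startS Q j (assign _ _)   h = h []
≺-startS Q j (awrite _ _ _) h = h []
≺-startS Q j (ite _ _ _)    h = h []
≺-startS Q j (while _ _)    h = h (iter 0 ∷ [])

≺-startFrom : ∀ {tp} Q X j (ss : Block nI nA) →
  tp ≺ X → (∀ r → tp ≺ Q ++ stmt j ∷ r) → tp ≺ startFrom Q X j ss
≺-startFrom Q X j []      tp≺X _ = tp≺X
≺-startFrom Q X j (s ∷ _) _    h = ≺-startS Q j s h

EndsAfter : TP → ℕ → TP → Set
EndsAfter Q j end = ∀ r → Q ++ stmt j ∷ r ≺ end

ExitsAfter : TP → TP → ℕ → Set
ExitsAfter Q X n = ∀ k → k < n → EndsAfter Q k X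

head-endsAfter : ∀ Q X j (s : Stmt nI nA) ss →
  ExitsAfter Q X (j + length (s ∷ ss)) → EndsAfter Q j (startFrom Q X (suc j) ss)
head-endsAfter Q X j s ss ok r =
  ≺-startFrom Q X (suc j) ss (ok j (m<m+n j (s≤s z≤n)) r)
    (λ _ → ≺-++ˡ Q (head< (stmt< ≤-refl)))

tail-exitsAfter : ∀ Q X j (s : Stmt nI nA) ss →
  ExitsAfter Q X (j + length (s ∷ ss)) → ExitsAfter Q X (suc j + length ss)
tail-exitsAfter Q X j s ss ok k k< = ok k (subst (k <_) (sym (+-suc j (length ss))) k<)

nested-exitsAfter : ∀ Q {X n} → (∀ r → Q ++ r ≺ X) → ExitsAfter Q X n
nested-exitsAfter Q below k _ r = below (stmt k ∷ r)

branch-exitsAfter : ∀ Q j end x {n} →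
  EndsAfter Q j end → ExitsAfter (Q ++ stmt j ∷ x ∷ []) end n
branch-exitsAfter Q j end x ok = nested-exitsAfter (Q ++ stmt j ∷ x ∷ []) λ r →
  subst (_≺ end) (sym (++-assoc Q (stmt j ∷ x ∷ []) r)) (ok (x ∷ r))

program-exitsAfter : (p : Program nI nA) → ExitsAfter [] (endP p) (length p)
program-exitsAfter p k k<n r = head< (stmt< k<n)

mutual
  stepS-≺ : ∀ {Q end j} {s : Stmt nI nA} {κ κ'} → StepS Q end j s κ κ' →
    EndsAfter Q j end → proj₁ κ ≺ proj₁ κ'
  stepS-≺ skipR   ok = ok []
  stepS-≺ assignR ok = ok []
  stepS-≺ awriteR ok = ok []
  stepS-≺ {Q = Q} {end} {j} (iteT {t = t} _) ok =
    ≺-startFrom _ end 0 t (ok []) (λ r → point-≺-branch Q j thenB (stmt 0 ∷ r))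
  stepS-≺ {Q = Q} {end} {j} (iteF {e = e} _) ok =
    ≺-startFrom _ end 0 e (ok []) (λ r → point-≺-branch Q j elseB (stmt 0 ∷ r))
  stepS-≺ {Q = Q} {end} {j} (iteInT d) ok = stepB-≺ d (branch-exitsAfter Q j end thenB ok)
  stepS-≺ {Q = Q} {end} {j} (iteInE d) ok = stepB-≺ d (branch-exitsAfter Q j end elseB ok)
  stepS-≺ {Q = Q} {j = j} (whileT {b = b} {it = it} _) _ =
    ≺-startFrom (hdr Q j it) _ 0 b (hdr-≺ Q j it) (λ _ → ≺-extend (hdr Q j it))
  stepS-≺ (whileF {it = it} _) ok = ok (iter it ∷ [])
  stepS-≺ {Q = Q} {j = j} (whileIn {it = it} d) _ =
    stepB-≺ d (nested-exitsAfter (hdr Q j it) (body-≺-next Q j it))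

  stepB-≺ : ∀ {Q X j} {ss : Block nI nA} {κ κ'} → StepB Q X j ss κ κ' →
    ExitsAfter Q X (j + length ss) → proj₁ κ ≺ proj₁ κ'
  stepB-≺ {Q = Q} {X} {j} {s ∷ ss} (here d)  ok = stepS-≺ d (head-endsAfter Q X j s ss ok)
  stepB-≺ {Q = Q} {X} {j} {s ∷ ss} (there d) ok = stepB-≺ d (tail-exitsAfter Q X j s ss ok)

-- (2) Determinism of the small-step semantics

mutual
  stepS-source : ∀ {Q end j} {s : Stmt nI nA} {κ κ'} → StepS Q end j s κ κ' →
    ∃ λ r → proj₁ κ ≡ Q ++ stmt j ∷ r
  stepS-source skipR       = _ , refl
  stepS-source assignR     = _ , refl
  stepS-source awriteR     = _ , refl
  stepS-source (iteT _)    = _ , refl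
  stepS-source (iteF _)    = _ , refl
  stepS-source (iteInT d)  = _ , proj₂ (proj₂ (nested-source d))
  stepS-source (iteInE d)  = _ , proj₂ (proj₂ (nested-source d))
  stepS-source (whileT _)  = _ , refl
  stepS-source (whileF _)  = _ , refl
  stepS-source (whileIn d) = _ , proj₂ (proj₂ (nested-source d))

  stepB-source : ∀ {Q X j} {ss : Block nI nA} {κ κ'} → StepB Q X j ss κ κ' →
    ∃₂ λ k r → j ≤ k × k < j + length ss × proj₁ κ ≡ Q ++ stmt k ∷ r
  stepB-source {j = j} {s ∷ ss} (here d) =
    j , _ , ≤-refl , m<m+n j (s≤s z≤n) , proj₂ (stepS-source d)
  stepB-source {j = j} {s ∷ ss} (there d) with stepB-source d
  ... | k , r , j<k , k<end , e =
    k , r , <⇒≤ j<k , subst (k <_) (sym (+-suc j (length ss))) k<end , e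

  nested-source : ∀ {Q j x X} {b : Block nI nA} {κ κ'} →
    StepB (Q ++ stmt j ∷ x ∷ []) X 0 b κ κ' →
    ∃₂ λ k r → proj₁ κ ≡ Q ++ stmt j ∷ x ∷ stmt k ∷ r
  nested-source {Q = Q} {j} {x} d with stepB-source d
  ... | k , r , _ , _ , e = k , r , trans e (++-assoc Q (stmt j ∷ x ∷ []) (stmt k ∷ r))

point-not-nested : ∀ Q {j x X} {b : Block nI nA} {σ κ'} →
  ¬ StepB (Q ++ stmt j ∷ x ∷ []) X 0 b (Q ++ stmt j ∷ [] , σ) κ'
point-not-nested Q d with nested-source {Q = Q} d
... | _ , _ , e with ++-cancelˡ Q _ _ e
... | ()

header-not-nested : ∀ Q {j x X it} {b : Block nI nA} {σ κ'} →
  ¬ StepB (Q ++ stmt j ∷ x ∷ []) X 0 b (hdr Q j it , σ) κ'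
header-not-nested Q d with nested-source {Q = Q} d
... | _ , _ , e with ++-cancelˡ Q _ _ e
... | ()

nested-same : ∀ Q {j x y X Y} {b b' : Block nI nA} {κ κ₁ κ₂} →
  StepB (Q ++ stmt j ∷ x ∷ []) X 0 b κ κ₁ →
  StepB (Q ++ stmt j ∷ y ∷ []) Y 0 b' κ κ₂ → x ≡ y
nested-same Q d₁ d₂ with nested-source {Q = Q} d₁ | nested-source {Q = Q} d₂
... | _ , _ , e₁ | _ , _ , e₂ with ++-cancelˡ Q _ _ (trans (sym e₁) e₂)
... | refl = refl

here-not-there : ∀ {Q end X j} {s : Stmt nI nA} {ss κ κ₁ κ₂} →
  StepS Q end j s κ κ₁ → ¬ StepB Q X (suc j) ss κ κ₂
here-not-there {Q = Q} d₁ d₂ with stepS-source d₁ | stepB-source d₂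
... | _ , e₁ | _ , _ , j<k , _ , e₂ with ++-cancelˡ Q _ _ (trans (sym e₁) e₂)
... | refl = <-irrefl refl j<k

header-injective : ∀ Q {j j' i i'} → hdr Q j i ≡ hdr Q j' i' → i ≡ i'
header-injective Q e with ++-cancelˡ Q _ _ e
... | refl = refl

mutual
  stepS-det : ∀ {Q end j} {s : Stmt nI nA} {κ₁ κ₂ κ₁' κ₂'} →
    StepS Q end j s κ₁ κ₁' → StepS Q end j s κ₂ κ₂' → κ₁ ≡ κ₂ → κ₁' ≡ κ₂'
  stepS-det skipR   skipR   refl = refl
  stepS-det assignR assignR refl = refl
  stepS-det awriteR awriteR refl = refl
  -- conditionals: the condition decides the branch, nested steps are apart
  stepS-det (iteT _)   (iteT _)   refl = refl
  stepS-det (iteF _)   (iteF _)   refl = refl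
  stepS-det (iteT h)   (iteF ¬h)  refl = ⊥-elim (¬h h)
  stepS-det (iteF ¬h)  (iteT h)   refl = ⊥-elim (¬h h)
  stepS-det {Q = Q} (iteT _)   (iteInT d) refl = ⊥-elim (point-not-nested Q d)
  stepS-det {Q = Q} (iteT _)   (iteInE d) refl = ⊥-elim (point-not-nested Q d)
  stepS-det {Q = Q} (iteF _)   (iteInT d) refl = ⊥-elim (point-not-nested Q d)
  stepS-det {Q = Q} (iteF _)   (iteInE d) refl = ⊥-elim (point-not-nested Q d)
  stepS-det {Q = Q} (iteInT d) (iteT _)   refl = ⊥-elim (point-not-nested Q d)
  stepS-det {Q = Q} (iteInT d) (iteF _)   refl = ⊥-elim (point-not-nested Q d)
  stepS-det {Q = Q} (iteInE d) (iteT _)   refl = ⊥-elim (point-not-nested Q d)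
  stepS-det {Q = Q} (iteInE d) (iteF _)   refl = ⊥-elim (point-not-nested Q d)
  stepS-det (iteInT d₁) (iteInT d₂) q = stepB-det d₁ d₂ q
  stepS-det (iteInE d₁) (iteInE d₂) q = stepB-det d₁ d₂ q
  stepS-det {Q = Q} (iteInT d₁) (iteInE d₂) refl with nested-same Q d₁ d₂
  ... | ()
  stepS-det {Q = Q} (iteInE d₁) (iteInT d₂) refl with nested-same Q d₁ d₂
  ... | ()
  -- loops: headers determine the iteration, the condition decides entry
  stepS-det {Q = Q} {j = j} (whileT {b = b} _) (whileT _) q =
    cong₂ (λ i σ → startFrom (hdr Q j i) (hdr Q j (suc i)) 0 b , σ)
          (header-injective Q (cong proj₁ q)) (cong proj₂ q)
  stepS-det {end = end} (whileF _) (whileF _) q = cong (λ κ → end , proj₂ κ) q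
  stepS-det (whileT {c = c} h) (whileF ¬h) q =
    ⊥-elim (¬h (subst (λ σ → holds σ c) (cong proj₂ q) h))
  stepS-det (whileF ¬h) (whileT {c = c} h) q =
    ⊥-elim (¬h (subst (λ σ → holds σ c) (sym (cong proj₂ q)) h))
  stepS-det {Q = Q} (whileT _)  (whileIn d) refl = ⊥-elim (header-not-nested Q d)
  stepS-det {Q = Q} (whileF _)  (whileIn d) refl = ⊥-elim (header-not-nested Q d)
  stepS-det {Q = Q} (whileIn d) (whileT _)  refl = ⊥-elim (header-not-nested Q d)
  stepS-det {Q = Q} (whileIn d) (whileF _)  refl = ⊥-elim (header-not-nested Q d)
  stepS-det {Q = Q} (whileIn d₁) (whileIn d₂) refl with nested-same Q d₁ d₂
  ... | refl = stepB-det d₁ d₂ refl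

  stepB-det : ∀ {Q X j} {ss : Block nI nA} {κ₁ κ₂ κ₁' κ₂'} →
    StepB Q X j ss κ₁ κ₁' → StepB Q X j ss κ₂ κ₂' → κ₁ ≡ κ₂ → κ₁' ≡ κ₂'
  stepB-det (here d₁)  (here d₂)  q    = stepS-det d₁ d₂ q
  stepB-det (there d₁) (there d₂) q    = stepB-det d₁ d₂ q
  stepB-det (here d₁)  (there d₂) refl = ⊥-elim (here-not-there d₁ d₂)
  stepB-det (there d₁) (here d₂)  refl = ⊥-elim (here-not-there d₂ d₁)

-- (3) Progress inside a statement

-- Conditions are decidable, so a conditional or a loop header can always step.
holds? : (σ : State nI nA) (c : Cond nI nA) → Dec (holds σ c)
holds? σ true      = yes tt
holds? σ false     = no λ ()
holds? σ (lt x y)  = eval σ x ℤ.<? eval σ y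
holds? σ (le x y)  = eval σ x ℤ.≤? eval σ y
holds? σ (eq x y)  = eval σ x ℤ.≟ eval σ y
holds? σ (not c)   = ¬? (holds? σ c)
holds? σ (and c d) = holds? σ c ×-dec holds? σ d
holds? σ (or c d)  = holds? σ c ⊎-dec holds? σ d

CanStepS : TP → TP → ℕ → Stmt nI nA → Config nI nA → Set
CanStepS Q end j s κ = ∃ λ κ' → StepS Q end j s κ κ'

CanStepB : TP → TP → ℕ → Block nI nA → Config nI nA → Set
CanStepB Q X j ss κ = ∃ λ κ' → StepB Q X j ss κ κ'

config-≡ : ∀ {κ : Config nI nA} {tp} → proj₁ κ ≡ tp → κ ≡ (tp , proj₂ κ)
config-≡ refl = refl

header-progress : ∀ {Q end j c} {b : Block nI nA} {it κ} → proj₁ κ ≡ hdr Q j it →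
  CanStepS Q end j (while c b) κ
header-progress {c = c} {κ = _ , σ} refl with holds? σ c
... | yes h = _ , whileT h
... | no ¬h = _ , whileF ¬h

start-progress : ∀ Q end j (s : Stmt nI nA) σ → CanStepS Q end j s (startS Q j s , σ)
start-progress Q end j skip           σ = _ , skipR
start-progress Q end j (assign _ _)   σ = _ , assignR
start-progress Q end j (awrite _ _ _) σ = _ , awriteR
start-progress Q end j (ite c _ _)    σ with holds? σ c
... | yes h = _ , iteT h
... | no ¬h = _ , iteF ¬h
start-progress Q end j (while _ _)    σ = header-progress refl

block-progress : ∀ Q X j (ss : Block nI nA) σ →
  startFrom Q X j ss ≡ X ⊎ CanStepB Q X j ss (startFrom Q X j ss , σ)
block-progress Q X j []      σ = inj₁ refl
block-progress Q X j (s ∷ _) σ = inj₂ (Prod.map₂ here (start-progress Q _ j s σ))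

loop-progress : ∀ {Q end j c} {b : Block nI nA} {it κ} →
  proj₁ κ ≡ hdr Q j (suc it) ⊎ CanStepB (hdr Q j it) (hdr Q j (suc it)) 0 b κ →
  CanStepS Q end j (while c b) κ
loop-progress (inj₁ e)        = header-progress e
loop-progress (inj₂ (_ , d)) = _ , whileIn d

mutual
  stepS-progress : ∀ {Q end j} {s : Stmt nI nA} {κ κ'} → StepS Q end j s κ κ' →
    proj₁ κ' ≡ end ⊎ CanStepS Q end j s κ'
  stepS-progress skipR      = inj₁ refl
  stepS-progress assignR    = inj₁ refl
  stepS-progress awriteR    = inj₁ refl
  stepS-progress (whileF _) = inj₁ refl
  stepS-progress {end = end} (iteT {t = t} {σ = σ} _) =
    Sum.map₂ (Prod.map₂ iteInT) (block-progress _ end 0 t σ)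
  stepS-progress {end = end} (iteF {e = e} {σ = σ} _) =
    Sum.map₂ (Prod.map₂ iteInE) (block-progress _ end 0 e σ)
  stepS-progress (iteInT d) = Sum.map₂ (Prod.map₂ iteInT) (stepB-progress d)
  stepS-progress (iteInE d) = Sum.map₂ (Prod.map₂ iteInE) (stepB-progress d)
  stepS-progress {Q = Q} {j = j} (whileT {b = b} {it = it} {σ = σ} _) =
    inj₂ (loop-progress (block-progress (hdr Q j it) _ 0 b σ))
  stepS-progress (whileIn d) = inj₂ (loop-progress (stepB-progress d))

  stepB-progress : ∀ {Q X j} {ss : Block nI nA} {κ κ'} → StepB Q X j ss κ κ' →
    proj₁ κ' ≡ X ⊎ CanStepB Q X j ss κ'
  stepB-progress (there d) = Sum.map₂ (Prod.map₂ there) (stepB-progress d)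
  stepB-progress {Q = Q} {X} (here {j = j} {ss = ss} {κ' = κ'} d) with stepS-progress d
  ... | inj₂ can = inj₂ (Prod.map₂ here can)
  ... | inj₁ e with block-progress Q X (suc j) ss (proj₂ κ')
  ...   | inj₁ e' = inj₁ (trans e e')
  ...   | inj₂ (κ'' , d') =
    inj₂ (κ'' , there (subst (λ κ → StepB Q X (suc j) ss κ κ'') (sym (config-≡ e)) d'))

-- (4) States

eqState-sym : ∀ {σ τ : State nI nA} → EqState σ τ → EqState τ σ
eqState-sym (ι , α) = (λ v → sym (ι v)) , (λ a k → sym (α a k))

eqState-trans : ∀ {σ τ ρ : State nI nA} → EqState σ τ → EqState τ ρ → EqState σ ρ
eqState-trans (ι , α) (ι' , α') =
  (λ v → trans (ι v) (ι' v)) , (λ a k → trans (α a k) (α' a k))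

eval-ext : ∀ {σ τ : State nI nA} → EqState σ τ → ∀ e → eval σ e ≡ eval τ e
eval-ext σ≈τ (const z)     = refl
eval-ext σ≈τ (var v)       = proj₁ σ≈τ v
eval-ext {τ = τ} σ≈τ (read a e) =
  trans (proj₂ σ≈τ a _) (cong (proj₂ τ a) (eval-ext σ≈τ e))
eval-ext σ≈τ (plus x y)    = cong₂ ℤ._+_ (eval-ext σ≈τ x) (eval-ext σ≈τ y)
eval-ext σ≈τ (minus x y)   = cong₂ ℤ._-_ (eval-ext σ≈τ x) (eval-ext σ≈τ y)
eval-ext σ≈τ (times x y)   = cong₂ ℤ._*_ (eval-ext σ≈τ x) (eval-ext σ≈τ y)

holds-ext : ∀ {σ τ : State nI nA} → EqState σ τ → ∀ c → holds σ c → holds τ c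
holds-ext σ≈τ true      h        = h
holds-ext σ≈τ false     h        = h
holds-ext σ≈τ (lt x y)  h        = subst₂ ℤ._<_ (eval-ext σ≈τ x) (eval-ext σ≈τ y) h
holds-ext σ≈τ (le x y)  h        = subst₂ ℤ._≤_ (eval-ext σ≈τ x) (eval-ext σ≈τ y) h
holds-ext σ≈τ (eq x y)  h        = trans (sym (eval-ext σ≈τ x)) (trans h (eval-ext σ≈τ y))
holds-ext σ≈τ (not c)   ¬h       = λ h → ¬h (holds-ext (eqState-sym σ≈τ) c h)
holds-ext σ≈τ (and c d) (h , h') = holds-ext σ≈τ c h , holds-ext σ≈τ d h'
holds-ext σ≈τ (or c d)  (inj₁ h) = inj₁ (holds-ext σ≈τ c h)
holds-ext σ≈τ (or c d)  (inj₂ h) = inj₂ (holds-ext σ≈τ d h)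

updI-same : ∀ (σ : State nI nA) v z → proj₁ (updI σ v z) v ≡ z
updI-same σ v z with v Fin.≟ v
... | yes _ = refl
... | no v≢v = ⊥-elim (v≢v refl)

updI-other : ∀ (σ : State nI nA) v z w → ¬ w ≡ v → proj₁ (updI σ v z) w ≡ proj₁ σ w
updI-other σ v z w w≢v with w Fin.≟ v
... | yes w≡v = ⊥-elim (w≢v w≡v)
... | no _    = refl

updA-same : ∀ (σ : State nI nA) a k z → proj₂ (updA σ a k z) a k ≡ z
updA-same σ a k z with a Fin.≟ a | k ℤ.≟ k
... | yes _   | yes _   = refl
... | yes _   | no k≢k  = ⊥-elim (k≢k refl)
... | no a≢a  | _       = ⊥-elim (a≢a refl)

updA-other-cell : ∀ (σ : State nI nA) a k z k' → ¬ k' ≡ k →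
  proj₂ (updA σ a k z) a k' ≡ proj₂ σ a k'
updA-other-cell σ a k z k' k'≢k with a Fin.≟ a | k' ℤ.≟ k
... | yes _ | yes k'≡k = ⊥-elim (k'≢k k'≡k)
... | yes _ | no _     = refl
... | no _  | _        = refl

updA-other-array : ∀ (σ : State nI nA) a k z b k' → ¬ b ≡ a →
  proj₂ (updA σ a k z) b k' ≡ proj₂ σ b k'
updA-other-array σ a k z b k' b≢a with b Fin.≟ a
... | yes b≡a = ⊥-elim (b≢a b≡a)
... | no _    = refl

-- (5) Soundness

module _ (M : Interp nI nA) where
  open Interp M

  assign-sem : ∀ {pre end j v e σ} → EqState (at (pre ++ stmt j ∷ [])) σ →
    EqState (at end) (updI σ v (eval σ e)) → SemS M pre end j (assign v e)
  assign-sem {v = v} {e} {σ} before after =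
      trans (proj₁ after v) (trans (updI-same σ v _) (sym (eval-ext before e)))
    , (λ w w≢v → trans (proj₁ after w)
        (trans (updI-other σ v _ w w≢v) (sym (proj₁ before w))))
    , (λ a k → trans (proj₂ after a k) (sym (proj₂ before a k)))

  awrite-sem : ∀ {pre end j a e₁ e₂ σ} → EqState (at (pre ++ stmt j ∷ [])) σ →
    EqState (at end) (updA σ a (eval σ e₁) (eval σ e₂)) → SemS M pre end j (awrite a e₁ e₂)
  awrite-sem {end = end} {a = a} {e₁} {e₂} {σ} before after =
      trans (cong (aval end a) (eval-ext before e₁))
        (trans (proj₂ after a _) (trans (updA-same σ a _ _) (sym (eval-ext before e₂))))
    , (λ k k≢i → trans (proj₂ after a k)
        (trans (updA-other-cell σ a _ _ k (λ k≡i → k≢i (trans k≡i (sym (eval-ext before e₁)))))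
          (sym (proj₂ before a k))))
    , (λ b k b≢a → trans (proj₂ after b k)
        (trans (updA-other-array σ a _ _ b k b≢a) (sym (proj₂ before b k))))
    , (λ v → trans (proj₁ after v) (sym (proj₁ before v)))

module Soundness {nI nA : ℕ} (p : Program nI nA) (E : Execution p) (M : Interp nI nA)
                 (IE : IsExecInterp p E M) where
  open Execution E
  open Interp M
  open IsExecInterp IE

  -- Statement s at (Q, j), resp. block ss, occurs in p: its transitions are transitions of p.
  InProgramS : TP → TP → ℕ → Stmt nI nA → Set
  InProgramS Q end j s = ∀ {κ κ'} → StepS Q end j s κ κ' → p ⊢ κ ⟶ κ'

  InProgramB : TP → TP → ℕ → Block nI nA → Set
  InProgramB Q X j ss = ∀ {κ κ'} → StepB Q X j ss κ κ' → p ⊢ κ ⟶ κ'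

  end-final : ∀ {σ κ'} → ¬ p ⊢ (endP p , σ) ⟶ κ'
  end-final d with stepB-source d
  ... | _ , _ , _ , k<n , refl = <-irrefl refl k<n

  record Visit (tp : TP) : Set where
    constructor visit
    field
      time     : ℕ
      time≤len : time ≤ len
      at-time  : proj₁ (run time) ≡ tp

    state : State nI nA
    state = proj₂ (run time)
  open Visit

  visit-of : ∀ {tp} → Reach tp → Visit tp
  visit-of r with reach-sound _ r
  ... | t , t≤len , e = visit t t≤len e

  reached : ∀ {tp} → Visit tp → Reach tp
  reached (visit t t≤len refl) = reach-complete t t≤len

  values : ∀ {tp} (v : Visit tp) → EqState (at tp) (state v)
  values (visit t t≤len refl) = ival-run t t≤len , aval-run t t≤len

  -- From a visit, the run next takes whichever transition of p we exhibit
  -- (by determinism); in particular the visit is not at the last index.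
  follow : ∀ {tp κ'} (v : Visit tp) → p ⊢ (tp , state v) ⟶ κ' →
    time v < len × run (suc (time v)) ≡ κ'
  follow (visit t t≤len refl) d with m≤n⇒m<n∨m≡n t≤len
  ... | inj₁ t<len = t<len , stepB-det (steps t t<len) d refl
  ... | inj₂ refl  =
    ⊥-elim (end-final (subst (λ tp → p ⊢ (tp , proj₂ (run len)) ⟶ _) final d))

  successor : ∀ {tp tp' σ'} (v : Visit tp) → p ⊢ (tp , state v) ⟶ (tp' , σ') → Visit tp'
  successor v d = visit (suc (time v)) (proj₁ (follow v d)) (cong proj₁ (proj₂ (follow v d)))

  values-after : ∀ {tp tp' σ'} (v : Visit tp) → p ⊢ (tp , state v) ⟶ (tp' , σ') →
    EqState (at tp') σ'
  values-after v d =
    subst (EqState (at _)) (cong proj₂ (proj₂ (follow v d))) (values (successor v d))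

  unchanged : ∀ {tp tp'} (v : Visit tp) → p ⊢ (tp , state v) ⟶ (tp' , state v) →
    EqState (at tp') (at tp)
  unchanged v d = eqState-trans (values-after v d) (eqState-sym (values v))

  run-≼ : ∀ {t t'} → t ≤ t' → t' ≤ len → proj₁ (run t) ≼ proj₁ (run t')
  run-≼ {t' = zero} z≤n _ = inj₁ refl
  run-≼ {t' = suc t'} t≤ t'<len with m≤n⇒m<n∨m≡n t≤
  ... | inj₂ refl       = inj₁ refl
  ... | inj₁ (s≤s t≤t') =
    inj₂ (≼-≺-trans (run-≼ t≤t' (<⇒≤ t'<len))
                    (stepB-≺ (steps t' t'<len) (program-exitsAfter p)))

  unreached-between : ∀ {a b x σ} (v : Visit a) → p ⊢ (a , state v) ⟶ (b , σ) →
    a ≺ x → x ≺ b → ¬ Reach x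
  unreached-between v d a≺x x≺b r with follow v d | visit-of r
  ... | t<len , q | visit k k≤len refl with k ≤? time v
  ...   | yes k≤t =
    ≼-≺-asym (run-≼ k≤t (<⇒≤ t<len)) (subst (_≺ _) (sym (at-time v)) a≺x)
  ...   | no k≰t  =
    ≼-≺-asym (run-≼ (≰⇒> k≰t) k≤len) (subst (_ ≺_) (sym (cong proj₁ q)) x≺b)

  -- Fuel bookkeeping: one unit of fuel pays for moving to a later index.
  spend : ∀ {f t t'} → len ≤ suc f + t → t < t' → len ≤ f + t'
  spend {f} {t} {t'} bound t<t' =
    ≤-trans bound (subst (_≤ f + t') (+-suc f t) (+-monoʳ-≤ f t<t'))

  -- Once inside a block of p, the run reaches the block's exit later on: the
  -- block keeps stepping until it exits, and the run is finite.
  leave-block : ∀ {Q X j} {ss : Block nI nA} → InProgramB Q X j ss →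
    ∀ f t → len ≤ f + t → t ≤ len → CanStepB Q X j ss (run t) → Σ (Visit X) λ w → t < time w
  leave-block emb f t bound t≤len (_ , d) with follow (visit t t≤len refl) (emb d) | stepB-progress d
  ... | t<len , q | inj₁ e = visit (suc t) t<len (trans (cong proj₁ q) e) , ≤-refl
  leave-block emb zero t bound t≤len _ | t<len , _ | inj₂ _ = ⊥-elim (<⇒≱ t<len bound)
  leave-block emb (suc f) t bound t≤len _ | t<len , q | inj₂ can =
    Prod.map₂ <⇒≤ (leave-block emb f (suc t) (spend bound ≤-refl) t<len
                               (subst (CanStepB _ _ _ _) (sym q) can))

  module Loop (Q end : TP) (j : ℕ) (c : Cond nI nA) (b : Block nI nA)
              (emb : InProgramS Q end j (while c b)) (ok : EndsAfter Q j end) where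

    H : ℕ → TP
    H = hdr Q j

    next-header : ∀ {n} (v : Visit (H n)) → holds (state v) c →
      Σ (Visit (H (suc n))) λ w → time v < time w
    next-header {n} v h
      with follow v (emb (whileT {it = n} h)) | block-progress (H n) (H (suc n)) 0 b (state v)
    ... | t<len , q | inj₁ e   = visit (suc (time v)) t<len (trans (cong proj₁ q) e) , ≤-refl
    ... | t<len , q | inj₂ can =
      Prod.map₂ <⇒≤ (leave-block (λ d → emb (whileIn d)) len (suc (time v)) (m≤m+n len _) t<len
                                 (subst (CanStepB _ _ _ _) (sym q) can))

    Passed : ℕ → Set
    Passed m = Σ (Visit (H m)) λ v → holds (state v) c

    pass : ∀ {n} → (∀ m → m < n → Passed m) → Passed n → ∀ m → m < suc n → Passed m
    pass before now m (s≤s m≤n) with m≤n⇒m<n∨m≡n m≤n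
    ... | inj₁ m<n = before m m<n
    ... | inj₂ refl = now

    record Exit : Set where
      field
        N          : ℕ
        exit-visit : Visit (H N)
        fails      : ¬ holds (state exit-visit) c
        passed     : ∀ m → m < N → Passed m

    find-exit : ∀ f n (v : Visit (H n)) → len ≤ f + time v → (∀ m → m < n → Passed m) → Exit
    find-exit f n v bound before with holds? (state v) c
    ... | no ¬h = record { N = n ; exit-visit = v ; fails = ¬h ; passed = before }
    find-exit zero n v bound before | yes h =
      ⊥-elim (<⇒≱ (proj₁ (follow v (emb (whileT {it = n} h)))) bound)
    find-exit (suc f) n v bound before | yes h with next-header v h
    ... | w , v<w = find-exit f (suc n) w (spend bound v<w) (pass before (v , h))

    -- [[while c b]] with L in place of lastIt.
    WhileSpec : ℕ → Set
    WhileSpec L =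
        (∀ it → it < L → holds (at (H it)) c)
      × ¬ holds (at (H L)) c
      × (∀ it → it < L → EqState (at (startFrom (H it) (H (suc it)) 0 b)) (at (H it)))
      × EqState (at end) (at (H L))

    exit-spec : (x : Exit) → WhileSpec (Exit.N x)
    exit-spec x =
        (λ it it<N → let (v , h) = passed it it<N in holds-ext (eqState-sym (values v)) c h)
      , (λ h → fails (holds-ext (values exit-visit) c h))
      , (λ it it<N → let (v , h) = passed it it<N in unchanged v (emb (whileT h)))
      , unchanged exit-visit (emb (whileF fails))
      where open Exit x

    -- The header w ++ [iter n] of the axioms for lastIt, with w = Q ++ [stmt j].
    as-header : ∀ n → (Q ++ stmt j ∷ []) ++ iter n ∷ [] ≡ H n
    as-header n = ++-assoc Q (stmt j ∷ []) (iter n ∷ [])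

    -- … and N is lastIt of the loop: header N is reached, while header N+1 lies
    -- strictly between header N and the loop's end, the next timepoint of the run.
    exit-lastIt : (x : Exit) → lastIt (Q ++ stmt j ∷ []) ≡ Exit.N x
    exit-lastIt x = lastIt-run (Q ++ stmt j ∷ []) N
      (subst Reach (sym (as-header N)) (reached exit-visit))
      (λ r → unreached-between exit-visit (emb (whileF fails)) (hdr-≺ Q j N)
               (ok (iter (suc N) ∷ [])) (subst Reach (as-header (suc N)) r))
      where open Exit x

    sem-while : Reach (H 0) → SemS M Q end j (while c b)
    sem-while r = subst WhileSpec (sym (exit-lastIt x)) (exit-spec x)
      where
      x : Exit
      x = find-exit len 0 (visit-of r) (m≤m+n len _) (λ _ ())

  stmt-sem : ∀ Q end j (s : Stmt nI nA) → InProgramS Q end j s → EndsAfter Q j end →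
    Reach (startS Q j s) → SemS M Q end j s
  stmt-sem Q end j skip           emb _ r = unchanged (visit-of r) (emb skipR)
  stmt-sem Q end j (assign _ e)   emb _ r =
    assign-sem M {e = e} (values v) (values-after v (emb assignR))
    where
    v : Visit (Q ++ stmt j ∷ [])
    v = visit-of r
  stmt-sem Q end j (awrite _ e₁ e₂) emb _ r =
    awrite-sem M {e₁ = e₁} {e₂} (values v) (values-after v (emb awriteR))
    where
    v : Visit (Q ++ stmt j ∷ [])
    v = visit-of r
  stmt-sem Q end j (ite c _ _)    emb _ r =
      (λ h → unchanged v (emb (iteT (holds-ext (values v) c h))))
    , (λ ¬h → unchanged v (emb (iteF (λ h → ¬h (holds-ext (eqState-sym (values v)) c h)))))
    where
    v : Visit (Q ++ stmt j ∷ [])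
    v = visit-of r
  stmt-sem Q end j (while c b)    emb ok r = Loop.sem-while Q end j c b emb ok r

  mutual
    sound-block : ∀ Q X j (ss : Block nI nA) → InProgramB Q X j ss →
      ExitsAfter Q X (j + length ss) → SatB M Q X j ss
    sound-block Q X j []       _   _  = tt
    sound-block Q X j (s ∷ ss) emb ok =
        sound-stmt Q _ j s (λ d → emb (here d)) (head-endsAfter Q X j s ss ok)
      , sound-block Q X (suc j) ss (λ d → emb (there d)) (tail-exitsAfter Q X j s ss ok)

    sound-stmt : ∀ Q end j (s : Stmt nI nA) → InProgramS Q end j s →
      EndsAfter Q j end → SatS M Q end j s
    sound-stmt Q end j s emb ok = stmt-sem Q end j s emb ok , sound-nested Q end j s emb ok

    sound-nested : ∀ Q end j (s : Stmt nI nA) → InProgramS Q end j s →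
      EndsAfter Q j end → SatSub M Q end j s
    sound-nested Q end j skip           _ _ = tt
    sound-nested Q end j (assign _ _)   _ _ = tt
    sound-nested Q end j (awrite _ _ _) _ _ = tt
    sound-nested Q end j (ite c t e) emb ok =
        sound-block _ end 0 t (λ d → emb (iteInT d)) (branch-exitsAfter Q j end thenB ok)
      , sound-block _ end 0 e (λ d → emb (iteInE d)) (branch-exitsAfter Q j end elseB ok)
    sound-nested Q end j (while c b) emb _ it =
      sound-block (hdr Q j it) _ 0 b (λ d → emb (whileIn d))
        (nested-exitsAfter (hdr Q j it) (body-≺-next Q j it))

-- Theorem 4: p₀ is a block of itself whose end comes after all its
-- statements.
theorem4 : ∀ {nI nA} (p₀ : Program nI nA) → Terminating p₀ →
           ∀ (E : Execution p₀) (M : Interp nI nA) → IsExecInterp p₀ E M → M ⊨⟦ p₀ ⟧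
theorem4 p₀ _ E M IE = sound-block [] (endP p₀) 0 p₀ (λ d → d) (program-exitsAfter p₀)
  where open Soundness p₀ E M IE
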